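{- The graph $\mathcal{G}_9$ is not $(2,2,2,2,2)$-packing colorable.
   Context: For a non-decreasing sequence $S=(s_1,\dots,s_k)$ of positive integers, an $S$-packing coloring of a graph $G$ is a partition of $V(G)$ into sets $V_1,\dots,V_k$ such that any two distinct vertices $u,v\in V_i$ satisfy $dist_G(u,v)>s_i$; $G$ is $S$-packing colorable if it admits one. $\mathcal{G}_9$ has vertices $y_1,\dots,y_7$ and edges $y_1y_2,y_2y_3,y_3y_4,y_4y_5,y_5y_1,y_5y_6,y_3y_6,y_6y_7,y_2y_7$. -}

module Defs where

open import Data.Nat using (ℕ; zero; suc; _≤_)
open import Data.Fin using (Fin; zero; suc)
open import Data.Vec using (Vec; lookup; _∷_; [])
open import Data.Product using (_×_; Σ; _,_; ∃-syntax)
open import Data.Sum using (_⊎_)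
open import Data.List using (List; _∷_; [])
open import Data.List.Membership.Propositional using (_∈_)
open import Relation.Nullary using (¬_)
open import Relation.Binary.PropositionalEquality using (_≡_)

Graph : ℕ → Set
Graph n = List (Fin n × Fin n)

Adj : ∀ {n} → Graph n → Fin n → Fin n → Set
Adj G u v = ((u , v) ∈ G) ⊎ ((v , u) ∈ G)

data Walk {n} (G : Graph n) : ℕ → Fin n → Fin n → Set where
  here : ∀ {u} → Walk G zero u u
  step : ∀ {k u w v} → Adj G u w → Walk G k w v → Walk G (suc k) u v

-- dist_G(u,v) ≤ s  :⇔ there is a u–v walk of length at most s
-- (dist is the minimum length of a u–v walk, ∞ if none).
DistLe : ∀ {n} → Graph n → Fin n → Fin n → ℕ → Set
DistLe G u v s = ∃[ k ] (k ≤ s × Walk G k u v)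

DistGt : ∀ {n} → Graph n → Fin n → Fin n → ℕ → Set
DistGt G u v s = ¬ DistLe G u v s

-- S-packing coloring for S = (s_1,…,s_k): a map c : V → {1..k}
-- (equivalently a partition V_1,…,V_k, classes possibly empty) such that
-- distinct vertices in the same class i are at distance > s_i.
IsSPackingColoring : ∀ {n k} → Graph n → Vec ℕ k → (Fin n → Fin k) → Set
IsSPackingColoring G S c =
  ∀ u v → ¬ (u ≡ v) → c u ≡ c v → DistGt G u v (lookup S (c u))

SPackingColorable : ∀ {n k} → Graph n → Vec ℕ k → Set
SPackingColorable {n} {k} G S = ∃[ c ] IsSPackingColoring {n} {k} G S c

y₁ y₂ y₃ y₄ y₅ y₆ y₇ : Fin 7
y₁ = zero
y₂ = suc zero
y₃ = suc (suc zero)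
y₄ = suc (suc (suc zero))
y₅ = suc (suc (suc (suc zero)))
y₆ = suc (suc (suc (suc (suc zero))))
y₇ = suc (suc (suc (suc (suc (suc zero)))))

𝒢₉ : Graph 7
𝒢₉ = (y₁ , y₂) ∷ (y₂ , y₃) ∷ (y₃ , y₄) ∷ (y₄ , y₅) ∷ (y₅ , y₁)
   ∷ (y₅ , y₆) ∷ (y₃ , y₆) ∷ (y₆ , y₇) ∷ (y₂ , y₇) ∷ []

-- The six vertices y₁, …, y₆ are pairwise at distance at most 2 (y₁ ⋯ y₅ is a 5-cycle and
-- y₆ is adjacent to y₃ and y₅). In a (2,2,2,2,2)-packing coloring every color class
-- contains at most one of them, so five colors cannot suffice, by pigeonhole.
module Submission where

open import Defs
open import Data.Nat using (ℕ; zero; suc; _≤_; _<_; s≤s)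
open import Data.Nat.Properties using (≤-trans; ≤-refl; ≤-reflexive)
open import Data.Fin using (Fin; toℕ; fromℕ<; inject₁)
open import Data.Fin.Properties using (_≟_; any?; all?; pigeonhole; <⇒≢; inject₁-injective; toℕ-fromℕ<; toℕ≤pred[n])
open import Data.Vec using (Vec; lookup; replicate; _∷_; [])
open import Data.Vec.Properties using (lookup-replicate)
open import Data.Product using (_×_; _,_; ∃-syntax)
open import Data.Product.Properties using (≡-dec)
open import Function using (_∘_; _⇔_; mk⇔)
open import Function.Definitions using (Injective)
open import Relation.Nullary using (¬_; Dec)
import Relation.Nullary.Decidable as Dec
open import Relation.Nullary.Decidable using (_⊎-dec_; _×-dec_; map′; decidable-stable; toWitness)
open import Relation.Binary.PropositionalEquality using (_≡_; refl; sym; subst)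

private
  variable
    n k m s t : ℕ
    G : Graph n
    u v : Fin n

DistLe-mono : DistLe G u v s → s ≤ t → DistLe G u v t
DistLe-mono (k , k≤s , walk) s≤t = k , ≤-trans k≤s s≤t , walk

adj? : (G : Graph n) (u v : Fin n) → Dec (Adj G u v)
adj? {n} G u v = ((u , v) ∈? G) ⊎-dec ((v , u) ∈? G)
  where open import Data.List.Membership.DecPropositional {A = Fin n × Fin n} (≡-dec _≟_ _≟_)

walk? : (G : Graph n) (k : ℕ) (u v : Fin n) → Dec (Walk G k u v)
walk? G zero u v = map′ (λ { refl → here }) (λ { here → refl }) (u ≟ v)
walk? G (suc k) u v =
  map′ (λ { (w , a , p) → step a p }) (λ { (step a p) → _ , a , p })
       (any? λ w → adj? G u w ×-dec walk? G k w v)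

bounded-walk⇔DistLe : (∃[ i ] Walk G (toℕ {suc s} i) u v) ⇔ DistLe G u v s
bounded-walk⇔DistLe {G = G} {u = u} {v} = mk⇔
  (λ (i , walk) → toℕ i , toℕ≤pred[n] i , walk)
  (λ (k , k≤s , walk) →
     fromℕ< (s≤s k≤s) , subst (λ l → Walk G l u v) (sym (toℕ-fromℕ< (s≤s k≤s))) walk)

distLe? : (G : Graph n) (u v : Fin n) (s : ℕ) → Dec (DistLe G u v s)
distLe? G u v s = Dec.map bounded-walk⇔DistLe (any? λ i → walk? G (toℕ i) u v)

coloring-injective-on-close-pairs :
  (S : Vec ℕ k) {c : Fin n → Fin k} → IsSPackingColoring G S c →
  (∀ i → s ≤ lookup S i) → DistLe G u v s → c u ≡ c v → u ≡ v
coloring-injective-on-close-pairs {u = u} {v} S {c} coloring s≤S close cu≡cv =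
  decidable-stable (u ≟ v) λ u≢v → coloring u v u≢v cu≡cv (DistLe-mono close (s≤S (c u)))

¬colorable-with-large-close-set :
  (S : Vec ℕ k) → (∀ i → s ≤ lookup S i) → k < m →
  (f : Fin m → Fin n) → Injective _≡_ _≡_ f → (∀ i j → DistLe G (f i) (f j) s) →
  ¬ SPackingColorable G S
¬colorable-with-large-close-set S s≤S k<m f f-injective close (c , coloring)
  with i , j , i<j , same-color ← pigeonhole k<m (c ∘ f)
  = <⇒≢ i<j (f-injective
      (coloring-injective-on-close-pairs S coloring s≤S (close i j) same-color))

-- inject₁ i is the vertex y_(i+1).
y₁⋯y₆-pairwise-within-2 : ∀ i j → DistLe 𝒢₉ (inject₁ i) (inject₁ j) 2
y₁⋯y₆-pairwise-within-2 =
  toWitness {a? = all? λ i → all? λ j → distLe? 𝒢₉ (inject₁ i) (inject₁ j) 2} _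

proposition9 : ¬ SPackingColorable 𝒢₉ (2 ∷ 2 ∷ 2 ∷ 2 ∷ 2 ∷ [])
proposition9 = ¬colorable-with-large-close-set (replicate 5 2)
  (λ i → ≤-reflexive (sym (lookup-replicate i 2))) ≤-refl
  inject₁ inject₁-injective y₁⋯y₆-pairwise-within-2
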